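{- Let $\pi$ be a permutation of $[n]=\{1,\dots,n\}$ with $n\ge 2$ that avoids the pattern 3-1-4-2 and is indecomposable. Then the letter $n$ appears to the left of the letter $1$ in $\pi$.
   Context: A permutation $\pi=a_1\cdots a_n$ avoids the (classical) pattern 3-1-4-2 if there are no indices $i<j<k<\ell$ with $a_j<a_\ell<a_i<a_k$. For permutations $\sigma$ of $[p]$ and $\tau$ of $[q]$, $\sigma\oplus\tau$ is the permutation of $[p+q]$ obtained by writing $\sigma$ followed by $\tau$ with $p$ added to each letter of $\tau$. A nonempty permutation is decomposable if it can be written $\sigma\oplus\tau$ with $\sigma,\tau$ both nonempty, and indecomposable otherwise. -}

module Defs where

open import Data.Nat using (ℕ; zero; suc; _+_; _<_; _≥_)
open import Data.Fin using (Fin; toℕ; splitAt; _↑ˡ_; _↑ʳ_; fromℕ)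
open import Data.Fin.Permutation using (Permutation′; _⟨$⟩ʳ_; _⟨$⟩ˡ_)
open import Data.Sum using (inj₁; inj₂)
open import Data.Product using (Σ; ∃; _×_; _,_)
open import Relation.Binary.PropositionalEquality using (_≡_; subst; sym)
open import Relation.Nullary using (¬_)

-- Convention: the permutation π = a₁⋯aₙ of [n] is a bijection
-- Fin n → Fin n sending position i (0-based) to the value a_{i+1} - 1.
-- So letter k ∈ [n] corresponds to the value k-1 : Fin n.

Contains3142 : ∀ {n} → Permutation′ n → Set
Contains3142 {n} π =
  Σ (Fin n) λ i → Σ (Fin n) λ j → Σ (Fin n) λ k → Σ (Fin n) λ l →
    (toℕ i < toℕ j) × (toℕ j < toℕ k) × (toℕ k < toℕ l) ×
    (toℕ (π ⟨$⟩ʳ j) < toℕ (π ⟨$⟩ʳ l)) ×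
    (toℕ (π ⟨$⟩ʳ l) < toℕ (π ⟨$⟩ʳ i)) ×
    (toℕ (π ⟨$⟩ʳ i) < toℕ (π ⟨$⟩ʳ k))

Avoids3142 : ∀ {n} → Permutation′ n → Set
Avoids3142 π = ¬ Contains3142 π

_⊕_ : ∀ {p q} → Permutation′ p → Permutation′ q → Fin (p + q) → Fin (p + q)
_⊕_ {p} {q} σ τ x with splitAt p x
... | inj₁ a = (σ ⟨$⟩ʳ a) ↑ˡ q
... | inj₂ b = p ↑ʳ (τ ⟨$⟩ʳ b)

Decomposable : ∀ {n} → Permutation′ n → Set
Decomposable {n} π =
  Σ ℕ λ p → Σ ℕ λ q → Σ (suc p + suc q ≡ n) λ eq →
  Σ (Permutation′ (suc p)) λ σ → Σ (Permutation′ (suc q)) λ τ →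
  ∀ (x : Fin n) → π ⟨$⟩ʳ x ≡ subst Fin eq ((σ ⊕ τ) (subst Fin (sym eq) x))

Indecomposable : ∀ {n} → Permutation′ n → Set
Indecomposable π = ¬ Decomposable π

-- Suppose 1 stands left of n, and let w be the least value standing at or right of n (values
-- and positions counted from 0). Then w ≠ 0 and every value below w stands left of n. As π is
-- indecomposable, the first w positions do not carry exactly the values below w, so (by
-- pigeonhole, in both directions) some position i < w carries a value ≥ w and some value
-- below w stands at a position j ≥ w, hence left of n. The positions i < j < pos n < pos w
-- then carry values with π(j) < w < π(i) < n: an occurrence of 3-1-4-2.
module Submission where

open import Defs
open import Data.Nat using (ℕ; suc; _<_)
open import Data.Fin using (Fin; toℕ; zero; fromℕ)
open import Data.Fin.Permutation using (Permutation′; _⟨$⟩ˡ_)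

open import Data.Nat using (_+_; _≤_; _<?_; _≤?_)
open import Data.Nat.Properties
  using (<⇒≤; <-trans; <-≤-trans; <⇒≢; m≤m+n; +-suc; m≤n⇒∃[o]m+o≡n; 1+n≰n; n≮n; ≰⇒>; ≮⇒≥; <⇒≱; ≤∧≢⇒<; n≢0⇒n>0)
open import Data.Fin as F using (fromℕ<; inject; inject≤; lower; _↑ˡ_; _↑ʳ_; splitAt; reduce≥)
open import Data.Fin.Properties
  using (toℕ-injective; toℕ<n; toℕ-fromℕ<; toℕ-inject; toℕ-inject≤; inject≤-injective; lower-injective;
         toℕ-↑ˡ; toℕ-↑ʳ; ↑ˡ-injective; ↑ʳ-injective; splitAt⁻¹-↑ˡ; splitAt⁻¹-↑ʳ; splitAt-≥; ≤fromℕ; injective⇒≤; any?; ¬∀⟶∃¬-smallest)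
open import Data.Fin.Permutation using (_⟨$⟩ʳ_; permutation; inverseˡ; inverseʳ; flip)
open import Data.Sum using (_⊎_; inj₁; inj₂)
open import Data.Product using (∃; _×_; _,_)
open import Function using (_∘_)
open import Function.Definitions using (Injective; StrictlyInverseˡ)
open import Relation.Nullary using (¬_; yes; no; contradiction)
open import Relation.Nullary.Decidable using (_×-dec_)
open import Level using (0ℓ)
open import Relation.Unary using (Pred; Decidable)
open import Relation.Binary.PropositionalEquality using (_≡_; refl; sym; trans; cong; subst; subst₂; module ≡-Reasoning)

MapsBelow : ∀ {n} → (Fin n → Fin n) → ℕ → Set
MapsBelow f c = ∀ x → toℕ x < c → toℕ (f x) < c

MapsAbove : ∀ {n} → (Fin n → Fin n) → ℕ → Set
MapsAbove f c = ∀ x → c ≤ toℕ x → c ≤ toℕ (f x)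

mapsBelow-or-escapes : ∀ {n} (f : Fin n → Fin n) c →
  MapsBelow f c ⊎ ∃ λ x → toℕ x < c × c ≤ toℕ (f x)
mapsBelow-or-escapes f c with any? (λ x → toℕ x <? c ×-dec c ≤? toℕ (f x))
... | yes escape = inj₂ escape
... | no ¬escape = inj₁ λ x x<c → ≰⇒> λ c≤fx → ¬escape (x , x<c , c≤fx)

least-counterexample : ∀ {n} (P : Pred (Fin n) 0ℓ) → Decidable P → ¬ (∀ x → P x) →
  ∃ λ w → ¬ P w × (∀ y → toℕ y < toℕ w → P y)
least-counterexample P P? ¬∀P with w , ¬Pw , P-below ← ¬∀⟶∃¬-smallest _ P P? ¬∀P =
  w , ¬Pw , λ y y<w → subst P (inject-fromℕ< y y<w) (P-below (fromℕ< y<w))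
  where
  inject-fromℕ< : ∀ y (y<w : toℕ y < toℕ w) → inject (fromℕ< y<w) ≡ y
  inject-fromℕ< y y<w = toℕ-injective (trans (toℕ-inject (fromℕ< y<w)) (toℕ-fromℕ< y<w))

module _ {n} (π : Permutation′ n) where

  ⟨$⟩ʳ≡⇒≡⟨$⟩ˡ : ∀ {x y} → π ⟨$⟩ʳ x ≡ y → x ≡ π ⟨$⟩ˡ y
  ⟨$⟩ʳ≡⇒≡⟨$⟩ˡ πx≡y = trans (sym (inverseˡ π)) (cong (π ⟨$⟩ˡ_) πx≡y)

  ⟨$⟩ʳ-injective : Injective _≡_ _≡_ (π ⟨$⟩ʳ_)
  ⟨$⟩ʳ-injective πx≡πy = trans (⟨$⟩ʳ≡⇒≡⟨$⟩ˡ πx≡πy) (inverseˡ π)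

  -- Pigeonhole: the c positions below c together with the position of y would be c + 1
  -- distinct positions sent below c.
  mapsBelow-inverse : ∀ {c} → c ≤ n → MapsBelow (π ⟨$⟩ʳ_) c → MapsBelow (π ⟨$⟩ˡ_) c
  mapsBelow-inverse {c} c≤n below y y<c =
    ≰⇒> λ c≤πy → 1+n≰n (injective⇒≤ (lowered-injective c≤πy))
    where
    e : Fin (suc c) → Fin n
    e zero = y
    e (F.suc k) = π ⟨$⟩ʳ inject≤ k c≤n

    e<c : ∀ k → toℕ (e k) < c
    e<c zero = y<c
    e<c (F.suc k) = below _ (subst (_< c) (sym (toℕ-inject≤ k c≤n)) (toℕ<n k))

    e-injective : c ≤ toℕ (π ⟨$⟩ˡ y) → Injective _≡_ _≡_ e
    e-injective _ {zero} {zero} _ = refl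
    e-injective c≤πy {zero} {F.suc k} y≡πk =
      contradiction (subst (λ x → c ≤ toℕ x) πy≡k c≤πy)
                    (<⇒≱ (subst (_< c) (sym (toℕ-inject≤ k c≤n)) (toℕ<n k)))
      where
      πy≡k : π ⟨$⟩ˡ y ≡ inject≤ k c≤n
      πy≡k = trans (cong (π ⟨$⟩ˡ_) y≡πk) (inverseˡ π)
    e-injective c≤πy {F.suc k} {zero} πk≡y = sym (e-injective c≤πy {zero} {F.suc k} (sym πk≡y))
    e-injective _ {F.suc k} {F.suc l} πk≡πl =
      cong F.suc (inject≤-injective c≤n c≤n k l (⟨$⟩ʳ-injective πk≡πl))

    lowered : Fin (suc c) → Fin c
    lowered k = lower (e k) (e<c k)

    lowered-injective : c ≤ toℕ (π ⟨$⟩ˡ y) → Injective _≡_ _≡_ lowered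
    lowered-injective c≤πy eq = e-injective c≤πy (lower-injective _ _ eq)

  mapsBelow-inverse⇒mapsAbove : ∀ {c} → MapsBelow (π ⟨$⟩ˡ_) c → MapsAbove (π ⟨$⟩ʳ_) c
  mapsBelow-inverse⇒mapsAbove below⁻¹ x c≤x =
    ≮⇒≥ λ πx<c → <⇒≱ (subst (λ z → toℕ z < _) (inverseˡ π) (below⁻¹ _ πx<c)) c≤x

module _ {k L : ℕ} where

  toℕ-↑ˡ-< : (a : Fin k) → toℕ (a ↑ˡ L) < k
  toℕ-↑ˡ-< a = subst (_< k) (sym (toℕ-↑ˡ a L)) (toℕ<n a)

  ≤-toℕ-↑ʳ : (b : Fin L) → k ≤ toℕ (k ↑ʳ b)
  ≤-toℕ-↑ʳ b = subst (k ≤_) (sym (toℕ-↑ʳ k b)) (m≤m+n k (toℕ b))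

  restrictˡ : (f : Fin (k + L) → Fin (k + L)) → MapsBelow f k → Fin k → Fin k
  restrictˡ f below a = fromℕ< (below (a ↑ˡ L) (toℕ-↑ˡ-< a))

  restrictʳ : (f : Fin (k + L) → Fin (k + L)) → MapsAbove f k → Fin L → Fin L
  restrictʳ f above b = reduce≥ (f (k ↑ʳ b)) (above (k ↑ʳ b) (≤-toℕ-↑ʳ b))

  restrictˡ-↑ˡ : ∀ f (below : MapsBelow f k) a → restrictˡ f below a ↑ˡ L ≡ f (a ↑ˡ L)
  restrictˡ-↑ˡ f below a = toℕ-injective (trans (toℕ-↑ˡ (restrictˡ f below a) L) (toℕ-fromℕ< _))

  restrictʳ-↑ʳ : ∀ f (above : MapsAbove f k) b → k ↑ʳ restrictʳ f above b ≡ f (k ↑ʳ b)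
  restrictʳ-↑ʳ f above b = splitAt⁻¹-↑ʳ (splitAt-≥ k (f (k ↑ʳ b)) _)

  restrictˡ-inverse : ∀ {f g} (f-below : MapsBelow f k) (g-below : MapsBelow g k) →
    StrictlyInverseˡ _≡_ f g → StrictlyInverseˡ _≡_ (restrictˡ f f-below) (restrictˡ g g-below)
  restrictˡ-inverse {f} {g} f-below g-below f∘g a = ↑ˡ-injective L _ _ (begin
    restrictˡ f f-below (restrictˡ g g-below a) ↑ˡ L  ≡⟨ restrictˡ-↑ˡ f f-below _ ⟩
    f (restrictˡ g g-below a ↑ˡ L)                   ≡⟨ cong f (restrictˡ-↑ˡ g g-below a) ⟩
    f (g (a ↑ˡ L))                                   ≡⟨ f∘g (a ↑ˡ L) ⟩
    a ↑ˡ L                                           ∎)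
    where open ≡-Reasoning

  restrictʳ-inverse : ∀ {f g} (f-above : MapsAbove f k) (g-above : MapsAbove g k) →
    StrictlyInverseˡ _≡_ f g → StrictlyInverseˡ _≡_ (restrictʳ f f-above) (restrictʳ g g-above)
  restrictʳ-inverse {f} {g} f-above g-above f∘g b = ↑ʳ-injective k _ _ (begin
    k ↑ʳ restrictʳ f f-above (restrictʳ g g-above b)  ≡⟨ restrictʳ-↑ʳ f f-above _ ⟩
    f (k ↑ʳ restrictʳ g g-above b)                   ≡⟨ cong f (restrictʳ-↑ʳ g g-above b) ⟩
    f (g (k ↑ʳ b))                                   ≡⟨ f∘g (k ↑ʳ b) ⟩
    k ↑ʳ b                                           ∎)
    where open ≡-Reasoning

module _ {k L : ℕ} (π : Permutation′ (k + L))
         (below : MapsBelow (π ⟨$⟩ʳ_) k) (below⁻¹ : MapsBelow (π ⟨$⟩ˡ_) k) where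

  private
    above : MapsAbove (π ⟨$⟩ʳ_) k
    above = mapsBelow-inverse⇒mapsAbove π below⁻¹

    above⁻¹ : MapsAbove (π ⟨$⟩ˡ_) k
    above⁻¹ = mapsBelow-inverse⇒mapsAbove (flip π) below

  lowerBlock : Permutation′ k
  lowerBlock = permutation (restrictˡ _ below) (restrictˡ _ below⁻¹)
    (restrictˡ-inverse below below⁻¹ (λ _ → inverseʳ π))
    (restrictˡ-inverse below⁻¹ below (λ _ → inverseˡ π))

  upperBlock : Permutation′ L
  upperBlock = permutation (restrictʳ _ above) (restrictʳ _ above⁻¹)
    (restrictʳ-inverse above above⁻¹ (λ _ → inverseʳ π))
    (restrictʳ-inverse above⁻¹ above (λ _ → inverseˡ π))

  ≡-lowerBlock-⊕-upperBlock : ∀ x → π ⟨$⟩ʳ x ≡ (lowerBlock ⊕ upperBlock) x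
  ≡-lowerBlock-⊕-upperBlock x with splitAt k x in split
  ... | inj₁ a = trans (cong (π ⟨$⟩ʳ_) (sym (splitAt⁻¹-↑ˡ split))) (sym (restrictˡ-↑ˡ _ below a))
  ... | inj₂ b = trans (cong (π ⟨$⟩ʳ_) (sym (splitAt⁻¹-↑ʳ split))) (sym (restrictʳ-↑ʳ _ above b))

mapsBelow⇒decomposable : ∀ {n} (π : Permutation′ n) {c} → 0 < c → c < n →
  MapsBelow (π ⟨$⟩ʳ_) c → Decomposable π
mapsBelow⇒decomposable π {suc p} _ c<n below with q , c+q≡n ← m≤n⇒∃[o]m+o≡n c<n =
  decomposable-at q (trans (+-suc (suc p) q) c+q≡n) π below
  where
  decomposable-at : ∀ {n} q → suc p + suc q ≡ n → (π : Permutation′ n) →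
    MapsBelow (π ⟨$⟩ʳ_) (suc p) → Decomposable π
  decomposable-at q refl π below =
    p , q , refl , lowerBlock π below below⁻¹ , upperBlock π below below⁻¹ ,
    ≡-lowerBlock-⊕-upperBlock π below below⁻¹
    where
    below⁻¹ : MapsBelow (π ⟨$⟩ˡ_) (suc p)
    below⁻¹ = mapsBelow-inverse π (m≤m+n (suc p) (suc q)) below

module _ {m : ℕ} (π : Permutation′ (suc (suc m))) where

  contains3142-from-escapes : ∀ (w i j : Fin (suc (suc m))) →
    (∀ y → toℕ y < toℕ w → toℕ (π ⟨$⟩ˡ y) < toℕ (π ⟨$⟩ˡ fromℕ (suc m))) →
    toℕ (π ⟨$⟩ˡ fromℕ (suc m)) ≤ toℕ (π ⟨$⟩ˡ w) →
    toℕ i < toℕ w → toℕ w ≤ toℕ (π ⟨$⟩ʳ i) →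
    toℕ j < toℕ w → toℕ w ≤ toℕ (π ⟨$⟩ˡ j) →
    Contains3142 π
  contains3142-from-escapes w i j left-of-n n≤w i<w w≤πi j<w w≤j′ =
    i , j′ , t , l , i<j′ , j′<t , t<l , πj′<πl , πl<πi , πi<πt
    where
    top t l j′ : Fin (suc (suc m))
    top = fromℕ (suc m)
    t = π ⟨$⟩ˡ top
    l = π ⟨$⟩ˡ w
    j′ = π ⟨$⟩ˡ j

    i<j′ : toℕ i < toℕ j′
    i<j′ = <-≤-trans i<w w≤j′
    j′<t : toℕ j′ < toℕ t
    j′<t = left-of-n j j<w
    i<t : toℕ i < toℕ t
    i<t = <-trans i<j′ j′<t
    w<πi : toℕ w < toℕ (π ⟨$⟩ʳ i)
    w<πi = ≤∧≢⇒< w≤πi λ w≡πi →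
      <⇒≱ i<t (subst (λ x → toℕ t ≤ toℕ x) (sym (⟨$⟩ʳ≡⇒≡⟨$⟩ˡ π (sym (toℕ-injective w≡πi)))) n≤w)
    t<l : toℕ t < toℕ l
    t<l = ≤∧≢⇒< n≤w λ t≡l →
      <⇒≢ (<-≤-trans w<πi (≤fromℕ _)) (cong toℕ (sym (⟨$⟩ʳ-injective (flip π) (toℕ-injective t≡l))))
    πj′<πl : toℕ (π ⟨$⟩ʳ j′) < toℕ (π ⟨$⟩ʳ l)
    πj′<πl = subst₂ (λ a b → toℕ a < toℕ b) (sym (inverseʳ π)) (sym (inverseʳ π)) j<w
    πl<πi : toℕ (π ⟨$⟩ʳ l) < toℕ (π ⟨$⟩ʳ i)
    πl<πi = subst (λ a → toℕ a < toℕ (π ⟨$⟩ʳ i)) (sym (inverseʳ π)) w<πi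
    πi<πt : toℕ (π ⟨$⟩ʳ i) < toℕ (π ⟨$⟩ʳ t)
    πi<πt = subst (λ a → toℕ (π ⟨$⟩ʳ i) < toℕ a) (sym (inverseʳ π)) (≤∧≢⇒< (≤fromℕ _) λ πi≡top →
      <⇒≢ i<t (cong toℕ (⟨$⟩ʳ≡⇒≡⟨$⟩ˡ π (toℕ-injective πi≡top))))

  private
    LeftOfN : Pred (Fin (suc (suc m))) 0ℓ
    LeftOfN y = toℕ (π ⟨$⟩ˡ y) < toℕ (π ⟨$⟩ˡ fromℕ (suc m))

  1-left-of-n⇒contains3142 : Indecomposable π →
    toℕ (π ⟨$⟩ˡ zero) < toℕ (π ⟨$⟩ˡ fromℕ (suc m)) → Contains3142 π
  1-left-of-n⇒contains3142 indec 1-left-of-n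
    with w , ¬w-left-of-n , left-of-n ←
           least-counterexample LeftOfN (λ y → _ <? _) (λ all → n≮n _ (all (fromℕ (suc m))))
    with n≢0⇒n>0 (λ w≡0 → ¬w-left-of-n (subst LeftOfN (sym (toℕ-injective w≡0)) 1-left-of-n))
       | mapsBelow-or-escapes (π ⟨$⟩ʳ_) (toℕ w) | mapsBelow-or-escapes (π ⟨$⟩ˡ_) (toℕ w)
  ... | 0<w | inj₁ below | _ = contradiction (mapsBelow⇒decomposable π 0<w (toℕ<n w) below) indec
  ... | 0<w | inj₂ _ | inj₁ below⁻¹ =
    contradiction (mapsBelow⇒decomposable π 0<w (toℕ<n w) below) indec
    where
    below : MapsBelow (π ⟨$⟩ʳ_) (toℕ w)
    below = mapsBelow-inverse (flip π) (<⇒≤ (toℕ<n w)) below⁻¹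
  ... | _ | inj₂ (i , i<w , w≤πi) | inj₂ (j , j<w , w≤j′) =
    contains3142-from-escapes w i j left-of-n (≮⇒≥ ¬w-left-of-n) i<w w≤πi j<w w≤j′

lemma1 : (m : ℕ) (π : Permutation′ (suc (suc m))) →
    Avoids3142 π → Indecomposable π →
    toℕ (π ⟨$⟩ˡ fromℕ (suc m)) < toℕ (π ⟨$⟩ˡ zero)
lemma1 m π avoids indec = ≤∧≢⇒< (≮⇒≥ (avoids ∘ 1-left-of-n⇒contains3142 π indec)) λ n≡1 →
  contradiction (⟨$⟩ʳ-injective (flip π) (toℕ-injective n≡1)) λ ()
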